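{- Let $q$ be an indeterminate (or a nonzero complex number that is not a root of unity), let $a,b$ be parameters and $n\ge1$. Let $Q_n$ be the linear operator on polynomials in $x$ given by $$Q_n=\frac{D}{q^{n-1}}\;e\!\left(\frac{[n]a+b}{q^{n-1}}D\right)E\!\left(-\frac{[n-1]a+b}{q^{n-2}}D\right).$$ Then, as operators on polynomials, $$Q_n=\sum_{k\ge0}\frac{\prod_{j=0}^{k-1}\Bigl(\bigl([j+1]-q^n[j]\bigr)a+\bigl(1-q^{j+1}\bigr)b\Bigr)}{[k]!}\left(\frac{D}{q^{n-1}}\right)^{k+1}.$$
   Context: $[n]=\frac{1-q^n}{1-q}$, $[n]!=\prod_{j=1}^n[j]$. $D$ is the $q$-differentiation operator in $x$: $Df(x)=\frac{f(x)-f(qx)}{(1-q)x}$. $e(z)=\sum_{k\ge0}\frac{z^k}{[k]!}$, $E(z)=\sum_{k\ge0}q^{\binom{k}{2}}\frac{z^k}{[k]!}$ (so $E(-z)=1/e(z)$); for a constant $c$, $e(cD)$ and $E(cD)$ are the corresponding power series in $D$, acting on polynomials as finite sums. -}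

module Defs where

open import Level using (Level; suc; _⊔_)
open import Algebra.Bundles using (CommutativeRing)
open import Relation.Nullary using (¬_)
open import Data.Nat as ℕ using (ℕ; zero)
open import Data.Nat.Combinatorics using (_C_)
open import Data.Integer as ℤ using (ℤ; +_; -[1+_])
open import Data.List using (List; []; _∷_; map; length)

record Field (c ℓ : Level) : Set (Level.suc (c ⊔ ℓ)) where
  field
    commutativeRing : CommutativeRing c ℓ
  open CommutativeRing commutativeRing public
  field
    _⁻¹      : Carrier → Carrier
    1≉0      : ¬ (1# ≈ 0#)
    ⁻¹-inverse : ∀ x → ¬ (x ≈ 0#) → x * (x ⁻¹) ≈ 1#

module QCalculus {c ℓ : Level} (F : Field c ℓ) (q : Field.Carrier F) where
  open Field F

  pow : Carrier → ℕ → Carrier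
  pow x zero = 1#
  pow x (ℕ.suc n) = x * pow x n

  qpow : ℤ → Carrier
  qpow (+ n) = pow q n
  qpow -[1+ n ] = pow (q ⁻¹) (ℕ.suc n)

  -- q-integer [n] = (1-qⁿ)/(1-q) = 1 + q + ... + q^(n-1)
  qint : ℕ → Carrier
  qint zero = 0#
  qint (ℕ.suc n) = 1# + q * qint n

  qfact : ℕ → Carrier
  qfact zero = 1#
  qfact (ℕ.suc n) = qint (ℕ.suc n) * qfact n

  -- Polynomials in x: coefficient lists, head = constant term.
  Poly : Set c
  Poly = List Carrier

  coeff : Poly → ℕ → Carrier
  coeff [] i = 0#
  coeff (a ∷ p) zero = a
  coeff (a ∷ p) (ℕ.suc i) = coeff p i

  _⊕_ : Poly → Poly → Poly
  [] ⊕ r = r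
  (a ∷ p) ⊕ [] = a ∷ p
  (a ∷ p) ⊕ (b ∷ r) = (a + b) ∷ (p ⊕ r)

  scale : Carrier → Poly → Poly
  scale k p = map (k *_) p

  -- q-derivative: D(Σ c_m x^m) = Σ_{m≥1} [m] c_m x^(m-1),
  -- i.e. (f(x) - f(qx)) / ((1-q)x) computed on monomials.
  Daux : ℕ → Poly → Poly
  Daux m [] = []
  Daux m (a ∷ p) = (qint m * a) ∷ Daux (ℕ.suc m) p

  D : Poly → Poly
  D [] = []
  D (a ∷ p) = Daux 1 p

  iter : ℕ → (Poly → Poly) → Poly → Poly
  iter zero T p = p
  iter (ℕ.suc k) T p = T (iter k T p)

  sumP : ℕ → (ℕ → Poly) → Poly
  sumP zero f = []
  sumP (ℕ.suc N) f = sumP N f ⊕ f N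

  -- the power series Σ_k s_k D^k acting on a polynomial p (finite sum:
  -- D^k p = 0 once k > deg p, so summing over k ≤ length p suffices)
  series : (ℕ → Carrier) → Poly → Poly
  series s p = sumP (ℕ.suc (length p)) (λ k → scale (s k) (iter k D p))

  eOp : Carrier → Poly → Poly
  eOp z = series (λ k → pow z k * (qfact k ⁻¹))

  EOp : Carrier → Poly → Poly
  EOp z = series (λ k → pow q (k C 2) * pow z k * (qfact k ⁻¹))

  Dn : ℕ → Poly → Poly
  Dn n p = scale (qpow (+ 1 ℤ.- + n)) (D p)

  Q : Carrier → Carrier → ℕ → Poly → Poly
  Q a b n p =
    Dn n (eOp ((qint n * a + b) * qpow (+ 1 ℤ.- + n))
             (EOp (- ((qint (n ℕ.∸ 1) * a + b) * qpow (+ 2 ℤ.- + n))) p))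

  prodCoef : Carrier → Carrier → ℕ → ℕ → Carrier
  prodCoef a b n zero = 1#
  prodCoef a b n (ℕ.suc k) =
    prodCoef a b n k *
      ((qint (ℕ.suc k) - pow q n * qint k) * a + (1# - pow q (ℕ.suc k)) * b)

  -- Σ_{k≥0} prodCoef_k / [k]! · (D/q^(n-1))^(k+1), acting on p
  -- (terms with k ≥ length p vanish on p)
  RHS : Carrier → Carrier → ℕ → Poly → Poly
  RHS a b n p = sumP (ℕ.suc (length p))
    (λ k → scale (prodCoef a b n k * (qfact k ⁻¹)) (iter (ℕ.suc k) (Dn n) p))

-- Writing p = Σ gᵢ xⁱ, the i-th coefficient of Σₖ sₖ Dᵏ p is Σₖ sₖ [i+1]⋯[i+k] g_{i+k}, so
-- composing two such series convolves their coefficient sequences.  For e(XD) E(YD) the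
-- convolution c satisfies [m+1] c_{m+1} = (X + qᵐ Y) cₘ, because [k+l+1] = [k+1] + q^{k+1}[l]
-- splits each term into a part shifting the e-index and a part shifting the E-index (the
-- q-binomial theorem); hence cₘ = ∏_{j<m} (X + qʲ Y) / [m]!.  With X and Y as in Qₙ each
-- factor X + qʲ Y is q^{1-n} times the j-th factor of the product on the right-hand side,
-- and the extra D/q^{n-1} in front turns Dᵐ into (D/q^{n-1})^{m+1}.
module Submission where

open import Function using (_∘_)
open import Relation.Nullary using (¬_)
open import Relation.Binary.PropositionalEquality as ≡ using (_≡_)
open import Data.Nat as ℕ using (ℕ; zero; suc; _≤_; _≥_; z≤n; s≤s)
import Data.Nat.Properties as ℕ
open import Data.Nat.Combinatorics using (_C_; nCk+nC[k+1]≡[n+1]C[k+1]; nC1≡n)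
open import Data.Integer as ℤ using (+_)
open import Data.List using ([]; _∷_; length)
open import Data.Sum using (inj₁; inj₂)
open import Algebra.Bundles using (CommutativeSemiring)
open import Defs

module FiniteSums {c ℓ} (R : CommutativeSemiring c ℓ) where
  open CommutativeSemiring R
  open import Relation.Binary.Reasoning.Setoid setoid
  open import Algebra.Properties.CommutativeSemigroup +-commutativeSemigroup using (interchange)

  ∑ : ℕ → (ℕ → Carrier) → Carrier
  ∑ zero f = 0#
  ∑ (suc N) f = f 0 + ∑ N (f ∘ suc)

  syntax ∑ N (λ k → e) = ∑[ k < N ] e

  ∑-cong : ∀ N {f g} → (∀ k → f k ≈ g k) → ∑ N f ≈ ∑ N g
  ∑-cong zero f≈g = refl
  ∑-cong (suc N) f≈g = +-cong (f≈g 0) (∑-cong N (f≈g ∘ suc))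

  ∑-suc : ∀ N f → ∑ (suc N) f ≈ ∑ N f + f N
  ∑-suc zero f = +-comm _ _
  ∑-suc (suc N) f = trans (+-congˡ (∑-suc N (f ∘ suc))) (sym (+-assoc _ _ _))

  ∑-zero : ∀ N {f} → (∀ k → f k ≈ 0#) → ∑ N f ≈ 0#
  ∑-zero zero f≈0 = refl
  ∑-zero (suc N) f≈0 = trans (+-cong (f≈0 0) (∑-zero N (f≈0 ∘ suc))) (+-identityʳ _)

  ∑-distrib-+ : ∀ N f g → ∑[ k < N ] (f k + g k) ≈ ∑ N f + ∑ N g
  ∑-distrib-+ zero f g = sym (+-identityʳ _)
  ∑-distrib-+ (suc N) f g =
    trans (+-congˡ (∑-distrib-+ N (f ∘ suc) (g ∘ suc))) (interchange _ _ _ _)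

  *-distribˡ-∑ : ∀ N x f → x * ∑ N f ≈ ∑[ k < N ] (x * f k)
  *-distribˡ-∑ zero x f = zeroʳ x
  *-distribˡ-∑ (suc N) x f = trans (distribˡ _ _ _) (+-congˡ (*-distribˡ-∑ N x (f ∘ suc)))

  VanishesFrom : ℕ → (ℕ → Carrier) → Set _
  VanishesFrom A f = ∀ k → A ≤ k → f k ≈ 0#

  ∑-truncate : ∀ A M f → VanishesFrom A f → A ≤ M → ∑ M f ≈ ∑ A f
  ∑-truncate zero M f f≈0 _ = ∑-zero M (λ k → f≈0 k z≤n)
  ∑-truncate (suc A) (suc M) f f≈0 (s≤s A≤M) =
    +-congˡ (∑-truncate A M (f ∘ suc) (λ k A≤k → f≈0 (suc k) (s≤s A≤k)) A≤M)

  ∑-bound-irrelevant : ∀ A B f → VanishesFrom A f → VanishesFrom B f → ∑ A f ≈ ∑ B f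
  ∑-bound-irrelevant A B f vA vB with ℕ.≤-total A B
  ... | inj₁ A≤B = sym (∑-truncate A B f vA A≤B)
  ... | inj₂ B≤A = ∑-truncate B A f vB B≤A

  antidiagonal : (ℕ → ℕ → Carrier) → ℕ → Carrier
  antidiagonal h zero = h 0 0
  antidiagonal h (suc m) = h 0 (suc m) + antidiagonal (h ∘ suc) m

  antidiagonal-cong : ∀ m {h h′} → (∀ k l → h k l ≈ h′ k l) → antidiagonal h m ≈ antidiagonal h′ m
  antidiagonal-cong zero h≈h′ = h≈h′ 0 0
  antidiagonal-cong (suc m) h≈h′ = +-cong (h≈h′ 0 (suc m)) (antidiagonal-cong m (h≈h′ ∘ suc))

  antidiagonal-distrib-+ : ∀ m f g →
    antidiagonal (λ k l → f k l + g k l) m ≈ antidiagonal f m + antidiagonal g m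
  antidiagonal-distrib-+ zero f g = refl
  antidiagonal-distrib-+ (suc m) f g =
    trans (+-congˡ (antidiagonal-distrib-+ m (f ∘ suc) (g ∘ suc))) (interchange _ _ _ _)

  antidiagonal-*-diagonal : ∀ m h (ψ : ℕ → Carrier) →
    antidiagonal (λ k l → h k l * ψ (k ℕ.+ l)) m ≈ antidiagonal h m * ψ m
  antidiagonal-*-diagonal zero h ψ = refl
  antidiagonal-*-diagonal (suc m) h ψ =
    trans (+-congˡ (antidiagonal-*-diagonal m (h ∘ suc) (ψ ∘ suc))) (sym (distribʳ _ _ _))

  antidiagonal-suc-last : ∀ m h →
    antidiagonal h (suc m) ≈ antidiagonal (λ k l → h k (suc l)) m + h (suc m) 0
  antidiagonal-suc-last zero h = refl
  antidiagonal-suc-last (suc m) h =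
    trans (+-congˡ (antidiagonal-suc-last m (h ∘ suc))) (sym (+-assoc _ _ _))

  -- Both sides equal the sum over the triangle k + l < N, taken row by row.
  ∑∑≈∑-antidiagonal : ∀ N h → (∀ k l → N ≤ k ℕ.+ l → h k l ≈ 0#) →
    ∑[ k < N ] ∑ N (h k) ≈ ∑ N (antidiagonal h)
  ∑∑≈∑-antidiagonal N h h≈0 = trans (∑∑≈triangle N h h≈0) (sym (∑-antidiagonal≈triangle N h))
    where
    triangle : ℕ → (ℕ → ℕ → Carrier) → Carrier
    triangle zero h = 0#
    triangle (suc N) h = ∑ (suc N) (h 0) + triangle N (h ∘ suc)

    ∑-antidiagonal≈triangle : ∀ N h → ∑ N (antidiagonal h) ≈ triangle N h
    ∑-antidiagonal≈triangle zero h = refl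
    ∑-antidiagonal≈triangle (suc N) h = begin
      h 0 0 + ∑[ m < N ] (h 0 (suc m) + antidiagonal (h ∘ suc) m)
        ≈⟨ +-congˡ (∑-distrib-+ N _ _) ⟩
      h 0 0 + (∑ N (h 0 ∘ suc) + ∑ N (antidiagonal (h ∘ suc)))
        ≈⟨ sym (+-assoc _ _ _) ⟩
      ∑ (suc N) (h 0) + ∑ N (antidiagonal (h ∘ suc))
        ≈⟨ +-congˡ (∑-antidiagonal≈triangle N (h ∘ suc)) ⟩
      triangle (suc N) h ∎

    ∑∑≈triangle : ∀ N h → (∀ k l → N ≤ k ℕ.+ l → h k l ≈ 0#) → ∑[ k < N ] ∑ N (h k) ≈ triangle N h
    ∑∑≈triangle zero h h≈0 = refl
    ∑∑≈triangle (suc N) h h≈0 = +-congˡ (begin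
      ∑[ k < N ] ∑ (suc N) (h (suc k))
        ≈⟨ ∑-cong N (λ k → trans (∑-suc N (h (suc k)))
             (trans (+-congˡ (h≈0 (suc k) N (s≤s (ℕ.m≤n+m N k)))) (+-identityʳ _))) ⟩
      ∑[ k < N ] ∑ N (h (suc k))
        ≈⟨ ∑∑≈triangle N (h ∘ suc) (λ k l → h≈0 (suc k) l ∘ s≤s) ⟩
      triangle N (h ∘ suc) ∎)

module FieldProperties {c ℓ} (F : Field c ℓ) where
  open Field F
  open import Relation.Binary.Reasoning.Setoid setoid
  open import Algebra.Properties.CommutativeSemigroup *-commutativeSemigroup using (interchange)

  *-cancelˡ-⁻¹ : ∀ {x y z} → ¬ x ≈ 0# → x * y ≈ z → y ≈ x ⁻¹ * z
  *-cancelˡ-⁻¹ {x} {y} {z} x≉0 xy≈z = begin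
    y               ≈⟨ sym (*-identityˡ y) ⟩
    1# * y          ≈⟨ *-congʳ (sym (trans (*-comm _ _) (⁻¹-inverse x x≉0))) ⟩
    (x ⁻¹ * x) * y  ≈⟨ *-assoc _ _ _ ⟩
    x ⁻¹ * (x * y)  ≈⟨ *-congˡ xy≈z ⟩
    x ⁻¹ * z        ∎

  *-nonzero : ∀ {x y} → ¬ x ≈ 0# → ¬ y ≈ 0# → ¬ x * y ≈ 0#
  *-nonzero x≉0 y≉0 xy≈0 = y≉0 (trans (*-cancelˡ-⁻¹ x≉0 xy≈0) (zeroʳ _))

  ⁻¹-distrib-* : ∀ {x y} → ¬ x ≈ 0# → ¬ y ≈ 0# → (x * y) ⁻¹ ≈ x ⁻¹ * y ⁻¹
  ⁻¹-distrib-* {x} {y} x≉0 y≉0 = sym (begin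
    x ⁻¹ * y ⁻¹         ≈⟨ *-cancelˡ-⁻¹ (*-nonzero x≉0 y≉0) xy[x⁻¹y⁻¹]≈1 ⟩
    (x * y) ⁻¹ * 1#     ≈⟨ *-identityʳ _ ⟩
    (x * y) ⁻¹          ∎)
    where
    xy[x⁻¹y⁻¹]≈1 : (x * y) * (x ⁻¹ * y ⁻¹) ≈ 1#
    xy[x⁻¹y⁻¹]≈1 = trans (interchange _ _ _ _)
      (trans (*-cong (⁻¹-inverse x x≉0) (⁻¹-inverse y y≉0)) (*-identityˡ 1#))

  1⁻¹≈1 : 1# ⁻¹ ≈ 1#
  1⁻¹≈1 = trans (sym (*-identityˡ _)) (⁻¹-inverse 1# 1≉0)

  +-transpose-⁻ : ∀ {u v w v′} → u + v′ ≈ w + v → u + - v ≈ w + - v′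
  +-transpose-⁻ {u} {v} {w} {v′} eq = begin
    u + - v                    ≈⟨ sym (+-identityʳ _) ⟩
    (u + - v) + 0#             ≈⟨ +-congˡ (sym (-‿inverseʳ v′)) ⟩
    (u + - v) + (v′ + - v′)    ≈⟨ +-interchange _ _ _ _ ⟩
    (u + v′) + (- v + - v′)    ≈⟨ +-congʳ eq ⟩
    (w + v) + (- v + - v′)     ≈⟨ +-congˡ (+-comm _ _) ⟩
    (w + v) + (- v′ + - v)     ≈⟨ +-interchange _ _ _ _ ⟩
    (w + - v′) + (v + - v)     ≈⟨ +-congˡ (-‿inverseʳ v) ⟩
    (w + - v′) + 0#            ≈⟨ +-identityʳ _ ⟩
    w + - v′                   ∎
    where
    open import Algebra.Properties.CommutativeSemigroup +-commutativeSemigroup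
      using () renaming (interchange to +-interchange)

module QCalculusProperties {c ℓ} (F : Field c ℓ) (q : Field.Carrier F) where
  open Field F
  open QCalculus F q
  open FiniteSums commutativeSemiring
  open FieldProperties F
  open import Relation.Binary.Reasoning.Setoid setoid
  open import Algebra.Solver.Ring.NaturalCoefficients.Default commutativeSemiring
    using (solve; _:+_; _:*_; _:=_)

  pow-+ : ∀ x k l → pow x (k ℕ.+ l) ≈ pow x k * pow x l
  pow-+ x zero l = sym (*-identityˡ _)
  pow-+ x (suc k) l = trans (*-congˡ (pow-+ x k l)) (sym (*-assoc _ _ _))

  qint-+ : ∀ k l → qint (k ℕ.+ l) ≈ qint k + pow q k * qint l
  qint-+ zero l = sym (trans (+-identityˡ _) (*-identityˡ _))
  qint-+ (suc k) l = begin
    1# + q * qint (k ℕ.+ l)               ≈⟨ +-congˡ (*-congˡ (qint-+ k l)) ⟩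
    1# + q * (qint k + pow q k * qint l)  ≈⟨ solve 4 (λ o x y z → o :+ x :* (y :+ z) := (o :+ x :* y) :+ x :* z)
                                               refl 1# q (qint k) (pow q k * qint l) ⟩
    (1# + q * qint k) + q * (pow q k * qint l)  ≈⟨ +-congˡ (sym (*-assoc _ _ _)) ⟩
    qint (suc k) + pow q (suc k) * qint l ∎

  qint-+-comm : ∀ k l → qint k + pow q k * qint l ≈ qint l + pow q l * qint k
  qint-+-comm k l = trans (sym (qint-+ k l)) (trans (reflexive (≡.cong qint (ℕ.+-comm k l))) (qint-+ l k))

  coeff-⊕ : ∀ p r i → coeff (p ⊕ r) i ≈ coeff p i + coeff r i
  coeff-⊕ [] r i = sym (+-identityˡ _)
  coeff-⊕ (x ∷ p) [] i = sym (+-identityʳ _)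
  coeff-⊕ (x ∷ p) (y ∷ r) zero = refl
  coeff-⊕ (x ∷ p) (y ∷ r) (suc i) = coeff-⊕ p r i

  coeff-scale : ∀ x p i → coeff (scale x p) i ≈ x * coeff p i
  coeff-scale x [] i = sym (zeroʳ x)
  coeff-scale x (y ∷ p) zero = refl
  coeff-scale x (y ∷ p) (suc i) = coeff-scale x p i

  coeff-sumP : ∀ N f i → coeff (sumP N f) i ≈ ∑[ k < N ] coeff (f k) i
  coeff-sumP zero f i = refl
  coeff-sumP (suc N) f i = begin
    coeff (sumP N f ⊕ f N) i                  ≈⟨ coeff-⊕ (sumP N f) (f N) i ⟩
    coeff (sumP N f) i + coeff (f N) i        ≈⟨ +-congʳ (coeff-sumP N f i) ⟩
    ∑[ k < N ] coeff (f k) i + coeff (f N) i  ≈⟨ sym (∑-suc N _) ⟩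
    ∑[ k < suc N ] coeff (f k) i              ∎

  coeff-vanishes : ∀ p → VanishesFrom (length p) (coeff p)
  coeff-vanishes [] j _ = refl
  coeff-vanishes (x ∷ p) (suc j) (s≤s len≤j) = coeff-vanishes p j len≤j

  coeff-Daux : ∀ m p i → coeff (Daux m p) i ≈ qint (i ℕ.+ m) * coeff p i
  coeff-Daux m [] i = sym (zeroʳ _)
  coeff-Daux m (x ∷ p) zero = refl
  coeff-Daux m (x ∷ p) (suc i) =
    trans (coeff-Daux (suc m) p i) (*-congʳ (reflexive (≡.cong qint (ℕ.+-suc i m))))

  coeff-D : ∀ p i → coeff (D p) i ≈ qint (suc i) * coeff p (suc i)
  coeff-D [] i = sym (zeroʳ _)
  coeff-D (x ∷ p) i = trans (coeff-Daux 1 p i) (*-congʳ (reflexive (≡.cong qint (ℕ.+-comm i 1))))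

  coeff-scaleD : ∀ x p i → coeff (scale x (D p)) i ≈ x * (qint (suc i) * coeff p (suc i))
  coeff-scaleD x p i = trans (coeff-scale x (D p) i) (*-congˡ (coeff-D p i))

  -- qFalling k i = [i+1][i+2]⋯[i+k], the factor in Dᵏ x^{i+k} = qFalling k i · xⁱ
  qFalling : ℕ → ℕ → Carrier
  qFalling zero i = 1#
  qFalling (suc k) i = qint (suc i) * qFalling k (suc i)

  qFalling-+ : ∀ k l i → qFalling k i * qFalling l (i ℕ.+ k) ≈ qFalling (k ℕ.+ l) i
  qFalling-+ zero l i = trans (*-identityˡ _) (reflexive (≡.cong (qFalling l) (ℕ.+-identityʳ i)))
  qFalling-+ (suc k) l i = begin
    (qint (suc i) * qFalling k (suc i)) * qFalling l (i ℕ.+ suc k)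
      ≈⟨ *-assoc _ _ _ ⟩
    qint (suc i) * (qFalling k (suc i) * qFalling l (i ℕ.+ suc k))
      ≈⟨ *-congˡ (*-congˡ (reflexive (≡.cong (qFalling l) (ℕ.+-suc i k)))) ⟩
    qint (suc i) * (qFalling k (suc i) * qFalling l (suc i ℕ.+ k))
      ≈⟨ *-congˡ (qFalling-+ k l (suc i)) ⟩
    qint (suc i) * qFalling (k ℕ.+ l) (suc i) ∎

  coeff-iter-scaleD : ∀ x k p i →
    coeff (iter k (scale x ∘ D) p) i ≈ pow x k * (qFalling k i * coeff p (i ℕ.+ k))
  coeff-iter-scaleD x zero p i =
    sym (trans (*-identityˡ _) (trans (*-identityˡ _) (reflexive (≡.cong (coeff p) (ℕ.+-identityʳ i)))))
  coeff-iter-scaleD x (suc k) p i = begin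
    coeff (scale x (D (iter k (scale x ∘ D) p))) i
      ≈⟨ coeff-scaleD x (iter k (scale x ∘ D) p) i ⟩
    x * (qint (suc i) * coeff (iter k (scale x ∘ D) p) (suc i))
      ≈⟨ *-congˡ (*-congˡ (coeff-iter-scaleD x k p (suc i))) ⟩
    x * (qint (suc i) * (pow x k * (qFalling k (suc i) * coeff p (suc i ℕ.+ k))))
      ≈⟨ solve 5 (λ c x y z w → c :* (x :* (y :* (z :* w))) := (c :* y) :* ((x :* z) :* w))
           refl x (qint (suc i)) (pow x k) (qFalling k (suc i)) (coeff p (suc i ℕ.+ k)) ⟩
    pow x (suc k) * (qFalling (suc k) i * coeff p (suc i ℕ.+ k))
      ≈⟨ *-congˡ (*-congˡ (reflexive (≡.cong (coeff p) (≡.sym (ℕ.+-suc i k))))) ⟩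
    pow x (suc k) * (qFalling (suc k) i * coeff p (i ℕ.+ suc k)) ∎

  coeff-iterD : ∀ k p i → coeff (iter k D p) i ≈ qFalling k i * coeff p (i ℕ.+ k)
  coeff-iterD zero p i = sym (trans (*-identityˡ _) (reflexive (≡.cong (coeff p) (ℕ.+-identityʳ i))))
  coeff-iterD (suc k) p i = begin
    coeff (D (iter k D p)) i                                    ≈⟨ coeff-D (iter k D p) i ⟩
    qint (suc i) * coeff (iter k D p) (suc i)                   ≈⟨ *-congˡ (coeff-iterD k p (suc i)) ⟩
    qint (suc i) * (qFalling k (suc i) * coeff p (suc i ℕ.+ k)) ≈⟨ sym (*-assoc _ _ _) ⟩
    qFalling (suc k) i * coeff p (suc i ℕ.+ k)
      ≈⟨ *-congˡ (reflexive (≡.cong (coeff p) (≡.sym (ℕ.+-suc i k)))) ⟩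
    qFalling (suc k) i * coeff p (i ℕ.+ suc k) ∎

  -- i-th coefficient of Σ_{k<N} sₖ Dᵏ applied to the polynomial with coefficient sequence g
  seriesCoeff : ℕ → (ℕ → Carrier) → (ℕ → Carrier) → ℕ → Carrier
  seriesCoeff N s g i = ∑[ k < N ] (s k * (qFalling k i * g (i ℕ.+ k)))

  seriesCoeff-cong : ∀ N {s s′ g g′} → (∀ k → s k ≈ s′ k) → (∀ j → g j ≈ g′ j) →
    ∀ i → seriesCoeff N s g i ≈ seriesCoeff N s′ g′ i
  seriesCoeff-cong N s≈s′ g≈g′ i = ∑-cong N (λ k → *-cong (s≈s′ k) (*-congˡ (g≈g′ _)))

  private
    seriesTerm-zero : ∀ (s g : ℕ → Carrier) i k → g (i ℕ.+ k) ≈ 0# → s k * (qFalling k i * g (i ℕ.+ k)) ≈ 0#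
    seriesTerm-zero s g i k g≈0 = trans (*-congˡ (trans (*-congˡ g≈0) (zeroʳ _))) (zeroʳ _)

  seriesCoeff-terms-vanish : ∀ A (s g : ℕ → Carrier) i → VanishesFrom A g →
    VanishesFrom A (λ k → s k * (qFalling k i * g (i ℕ.+ k)))
  seriesCoeff-terms-vanish A s g i g≈0 k A≤k =
    seriesTerm-zero s g i k (g≈0 _ (ℕ.≤-trans A≤k (ℕ.m≤n+m k i)))

  seriesCoeff-bound-irrelevant : ∀ A B (s g : ℕ → Carrier) i → VanishesFrom A g → VanishesFrom B g →
    seriesCoeff A s g i ≈ seriesCoeff B s g i
  seriesCoeff-bound-irrelevant A B s g i vA vB =
    ∑-bound-irrelevant A B _ (seriesCoeff-terms-vanish A s g i vA) (seriesCoeff-terms-vanish B s g i vB)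

  seriesCoeff-vanishes : ∀ A N (s g : ℕ → Carrier) → VanishesFrom A g → VanishesFrom A (seriesCoeff N s g)
  seriesCoeff-vanishes A N s g g≈0 i A≤i =
    ∑-zero N (λ k → seriesTerm-zero s g i k (g≈0 _ (ℕ.≤-trans A≤i (ℕ.m≤m+n i k))))

  coeff-series : ∀ (s : ℕ → Carrier) p i → coeff (series s p) i ≈ seriesCoeff (length p) s (coeff p) i
  coeff-series s p i = begin
    coeff (series s p) i
      ≈⟨ coeff-sumP (suc L) _ i ⟩
    ∑[ k < suc L ] coeff (scale (s k) (iter k D p)) i
      ≈⟨ ∑-cong (suc L) (λ k → trans (coeff-scale (s k) (iter k D p) i) (*-congˡ (coeff-iterD k p i))) ⟩
    seriesCoeff (suc L) s (coeff p) i
      ≈⟨ ∑-truncate L (suc L) _ (seriesCoeff-terms-vanish L s (coeff p) i (coeff-vanishes p)) (ℕ.n≤1+n L) ⟩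
    seriesCoeff L s (coeff p) i ∎
    where L = length p

  convolution : (ℕ → Carrier) → (ℕ → Carrier) → ℕ → Carrier
  convolution s t = antidiagonal (λ k l → s k * t l)

  seriesCoeff-seriesCoeff : ∀ L (s t g : ℕ → Carrier) i → VanishesFrom L g →
    seriesCoeff L s (seriesCoeff L t g) i ≈ seriesCoeff L (convolution s t) g i
  seriesCoeff-seriesCoeff L s t g i g≈0 = begin
    ∑[ k < L ] (s k * (qFalling k i * ∑[ l < L ] (t l * (qFalling l (i ℕ.+ k) * g (i ℕ.+ k ℕ.+ l)))))
      ≈⟨ ∑-cong L row ⟩
    ∑[ k < L ] ∑ L (h k)
      ≈⟨ ∑∑≈∑-antidiagonal L h h≈0 ⟩
    ∑ L (antidiagonal h)
      ≈⟨ ∑-cong L (λ m → antidiagonal-*-diagonal m (λ k l → s k * t l) (λ m → qFalling m i * g (i ℕ.+ m))) ⟩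
    seriesCoeff L (convolution s t) g i ∎
    where
    h : ℕ → ℕ → Carrier
    h k l = (s k * t l) * (qFalling (k ℕ.+ l) i * g (i ℕ.+ (k ℕ.+ l)))

    h≈0 : ∀ k l → L ≤ k ℕ.+ l → h k l ≈ 0#
    h≈0 k l L≤k+l = trans (*-congˡ (trans (*-congˡ (g≈0 _ (ℕ.≤-trans L≤k+l (ℕ.m≤n+m _ i)))) (zeroʳ _))) (zeroʳ _)

    entry : ∀ k l → s k * (qFalling k i * (t l * (qFalling l (i ℕ.+ k) * g (i ℕ.+ k ℕ.+ l)))) ≈ h k l
    entry k l = begin
      s k * (qFalling k i * (t l * (qFalling l (i ℕ.+ k) * g (i ℕ.+ k ℕ.+ l))))
        ≈⟨ solve 5 (λ a b x y z → a :* (b :* (x :* (y :* z))) := (a :* x) :* ((b :* y) :* z)) refl _ _ _ _ _ ⟩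
      (s k * t l) * ((qFalling k i * qFalling l (i ℕ.+ k)) * g (i ℕ.+ k ℕ.+ l))
        ≈⟨ *-congˡ (*-cong (qFalling-+ k l i) (reflexive (≡.cong g (ℕ.+-assoc i k l)))) ⟩
      h k l ∎

    row : ∀ k → s k * (qFalling k i * ∑[ l < L ] (t l * (qFalling l (i ℕ.+ k) * g (i ℕ.+ k ℕ.+ l)))) ≈ ∑ L (h k)
    row k = begin
      s k * (qFalling k i * ∑[ l < L ] (t l * (qFalling l (i ℕ.+ k) * g (i ℕ.+ k ℕ.+ l))))
        ≈⟨ *-congˡ (*-distribˡ-∑ L _ _) ⟩
      s k * ∑[ l < L ] (qFalling k i * (t l * (qFalling l (i ℕ.+ k) * g (i ℕ.+ k ℕ.+ l))))
        ≈⟨ *-distribˡ-∑ L _ _ ⟩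
      ∑[ l < L ] (s k * (qFalling k i * (t l * (qFalling l (i ℕ.+ k) * g (i ℕ.+ k ℕ.+ l)))))
        ≈⟨ ∑-cong L (entry k) ⟩
      ∑ L (h k) ∎

  coeff-series-series : ∀ (s t : ℕ → Carrier) p i →
    coeff (series s (series t p)) i ≈ seriesCoeff (length p) (convolution s t) (coeff p) i
  coeff-series-series s t p i = begin
    coeff (series s r) i
      ≈⟨ coeff-series s r i ⟩
    seriesCoeff (length r) s (coeff r) i
      ≈⟨ seriesCoeff-cong (length r) (λ _ → refl) (λ j → coeff-series t p j) i ⟩
    seriesCoeff (length r) s (seriesCoeff L t g) i
      ≈⟨ seriesCoeff-bound-irrelevant (length r) L s _ i
           (λ j len≤j → trans (sym (coeff-series t p j)) (coeff-vanishes r j len≤j))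
           (seriesCoeff-vanishes L L t g (coeff-vanishes p)) ⟩
    seriesCoeff L s (seriesCoeff L t g) i
      ≈⟨ seriesCoeff-seriesCoeff L s t g i (coeff-vanishes p) ⟩
    seriesCoeff L (convolution s t) g i ∎
    where
    r = series t p
    L = length p
    g = coeff p

  -- Σ_{k<L} ρₖ (xD)^{k+1} = xD · Σ_{k<L} ρₖ xᵏ Dᵏ, read off at the i-th coefficient
  coeff-∑-iter-scaleD : ∀ x (ρ : ℕ → Carrier) p i →
    coeff (sumP (suc (length p)) (λ k → scale (ρ k) (iter (suc k) (scale x ∘ D) p))) i
      ≈ x * (qint (suc i) * seriesCoeff (length p) (λ k → ρ k * pow x k) (coeff p) (suc i))
  coeff-∑-iter-scaleD x ρ p i = begin
    coeff (sumP (suc L) (λ k → scale (ρ k) (iter (suc k) (scale x ∘ D) p))) i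
      ≈⟨ coeff-sumP (suc L) _ i ⟩
    ∑[ k < suc L ] coeff (scale (ρ k) (iter (suc k) (scale x ∘ D) p)) i
      ≈⟨ ∑-cong (suc L) (λ k → trans (coeff-scale (ρ k) (iter (suc k) (scale x ∘ D) p) i) (*-congˡ (coeff-iter-scaleD x (suc k) p i))) ⟩
    ∑ (suc L) term
      ≈⟨ ∑-truncate L (suc L) term term-vanishes (ℕ.n≤1+n L) ⟩
    ∑ L term
      ≈⟨ ∑-cong L term≈ ⟩
    ∑[ k < L ] (x * (qint (suc i) * ((ρ k * pow x k) * (qFalling k (suc i) * g (suc i ℕ.+ k)))))
      ≈⟨ sym (*-distribˡ-∑ L _ _) ⟩
    x * ∑[ k < L ] (qint (suc i) * ((ρ k * pow x k) * (qFalling k (suc i) * g (suc i ℕ.+ k))))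
      ≈⟨ *-congˡ (sym (*-distribˡ-∑ L _ _)) ⟩
    x * (qint (suc i) * seriesCoeff L (λ k → ρ k * pow x k) g (suc i)) ∎
    where
    L = length p
    g = coeff p

    term : ℕ → Carrier
    term k = ρ k * (pow x (suc k) * (qFalling (suc k) i * g (i ℕ.+ suc k)))

    term-vanishes : VanishesFrom L term
    term-vanishes k L≤k = trans (*-congˡ (trans (*-congˡ (trans (*-congˡ
      (coeff-vanishes p _ (ℕ.≤-trans L≤k (ℕ.≤-trans (ℕ.n≤1+n k) (ℕ.m≤n+m (suc k) i))))) (zeroʳ _))) (zeroʳ _))) (zeroʳ _)

    term≈ : ∀ k → term k ≈ x * (qint (suc i) * ((ρ k * pow x k) * (qFalling k (suc i) * g (suc i ℕ.+ k))))
    term≈ k = begin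
      ρ k * (pow x (suc k) * (qFalling (suc k) i * g (i ℕ.+ suc k)))
        ≈⟨ *-congˡ (*-congˡ (*-congˡ (reflexive (≡.cong g (ℕ.+-suc i k))))) ⟩
      ρ k * ((x * pow x k) * ((qint (suc i) * qFalling k (suc i)) * g (suc i ℕ.+ k)))
        ≈⟨ solve 6 (λ r x y n f z → r :* ((x :* y) :* ((n :* f) :* z)) := x :* (n :* ((r :* y) :* (f :* z))))
             refl (ρ k) x (pow x k) (qint (suc i)) (qFalling k (suc i)) (g (suc i ℕ.+ k)) ⟩
      x * (qint (suc i) * ((ρ k * pow x k) * (qFalling k (suc i) * g (suc i ℕ.+ k)))) ∎

  qProduct : Carrier → Carrier → ℕ → Carrier
  qProduct X Y zero = 1#
  qProduct X Y (suc m) = qProduct X Y m * (X + pow q m * Y)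

  module _ {s t : ℕ → Carrier} {X Y : Carrier}
           (s-rec : ∀ k → qint (suc k) * s (suc k) ≈ X * s k)
           (t-rec : ∀ l → qint (suc l) * t (suc l) ≈ (Y * pow q l) * t l) where

    -- [k+l+1] = [k+1] + q^{k+1}[l]: the first part shifts s, the second shifts t.
    convolution-recurrence : ∀ m →
      qint (suc m) * convolution s t (suc m) ≈ (X + pow q m * Y) * convolution s t m
    convolution-recurrence m = begin
      qint (suc m) * antidiagonal φ (suc m)
        ≈⟨ *-comm _ _ ⟩
      antidiagonal φ (suc m) * qint (suc m)
        ≈⟨ sym (antidiagonal-*-diagonal (suc m) φ qint) ⟩
      antidiagonal (λ k l → φ k l * qint (k ℕ.+ l)) (suc m)
        ≈⟨ antidiagonal-cong (suc m) (λ k l → trans (*-congˡ (qint-+ k l)) (distribˡ (φ k l) _ _)) ⟩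
      antidiagonal (λ k l → shiftS k l + shiftT k l) (suc m)
        ≈⟨ antidiagonal-distrib-+ (suc m) shiftS shiftT ⟩
      antidiagonal shiftS (suc m) + antidiagonal shiftT (suc m)
        ≈⟨ +-cong ∑shiftS ∑shiftT ⟩
      antidiagonal φ m * X + antidiagonal φ m * (Y * pow q m)
        ≈⟨ solve 4 (λ c x y p → c :* x :+ c :* (y :* p) := (x :+ p :* y) :* c) refl (antidiagonal φ m) X Y (pow q m) ⟩
      (X + pow q m * Y) * antidiagonal φ m ∎
      where
      φ shiftS shiftT : ℕ → ℕ → Carrier
      φ k l = s k * t l
      shiftS k l = φ k l * qint k
      shiftT k l = φ k l * (pow q k * qint l)

      ∑shiftS : antidiagonal shiftS (suc m) ≈ antidiagonal φ m * X
      ∑shiftS = begin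
        φ 0 (suc m) * 0# + antidiagonal (shiftS ∘ suc) m
          ≈⟨ trans (+-congʳ (zeroʳ _)) (+-identityˡ _) ⟩
        antidiagonal (shiftS ∘ suc) m
          ≈⟨ antidiagonal-cong m (λ k l → begin
               (s (suc k) * t l) * qint (suc k)   ≈⟨ solve 3 (λ x y z → (x :* y) :* z := (z :* x) :* y) refl _ _ _ ⟩
               (qint (suc k) * s (suc k)) * t l   ≈⟨ *-congʳ (s-rec k) ⟩
               (X * s k) * t l                    ≈⟨ solve 3 (λ x y z → (x :* y) :* z := (y :* z) :* x) refl _ _ _ ⟩
               φ k l * X                          ∎) ⟩
        antidiagonal (λ k l → φ k l * X) m
          ≈⟨ antidiagonal-*-diagonal m φ (λ _ → X) ⟩
        antidiagonal φ m * X ∎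

      ∑shiftT : antidiagonal shiftT (suc m) ≈ antidiagonal φ m * (Y * pow q m)
      ∑shiftT = begin
        antidiagonal shiftT (suc m)
          ≈⟨ antidiagonal-suc-last m shiftT ⟩
        antidiagonal (λ k l → shiftT k (suc l)) m + φ (suc m) 0 * (pow q (suc m) * 0#)
          ≈⟨ trans (+-congˡ (trans (*-congˡ (zeroʳ _)) (zeroʳ _))) (+-identityʳ _) ⟩
        antidiagonal (λ k l → shiftT k (suc l)) m
          ≈⟨ antidiagonal-cong m (λ k l → begin
               (s k * t (suc l)) * (pow q k * qint (suc l))
                 ≈⟨ solve 4 (λ s t p a → (s :* t) :* (p :* a) := s :* (a :* t) :* p) refl _ _ _ _ ⟩
               s k * (qint (suc l) * t (suc l)) * pow q k
                 ≈⟨ *-congʳ (*-congˡ (t-rec l)) ⟩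
               s k * ((Y * pow q l) * t l) * pow q k
                 ≈⟨ solve 5 (λ s y p t r → s :* ((y :* p) :* t) :* r := (s :* t) :* (y :* (r :* p))) refl _ _ _ _ _ ⟩
               φ k l * (Y * (pow q k * pow q l))
                 ≈⟨ *-congˡ (*-congˡ (sym (pow-+ q k l))) ⟩
               φ k l * (Y * pow q (k ℕ.+ l)) ∎) ⟩
        antidiagonal (λ k l → φ k l * (Y * pow q (k ℕ.+ l))) m
          ≈⟨ antidiagonal-*-diagonal m φ (λ j → Y * pow q j) ⟩
        antidiagonal φ m * (Y * pow q m) ∎

    qfact-*-convolution : ∀ m → qfact m * convolution s t m ≈ qProduct X Y m * convolution s t 0
    qfact-*-convolution zero = refl
    qfact-*-convolution (suc m) = begin
      (qint (suc m) * qfact m) * convolution s t (suc m)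
        ≈⟨ solve 3 (λ a f c → (a :* f) :* c := f :* (a :* c)) refl _ _ _ ⟩
      qfact m * (qint (suc m) * convolution s t (suc m))
        ≈⟨ *-congˡ (convolution-recurrence m) ⟩
      qfact m * ((X + pow q m * Y) * convolution s t m)
        ≈⟨ solve 3 (λ f z c → f :* (z :* c) := z :* (f :* c)) refl _ _ _ ⟩
      (X + pow q m * Y) * (qfact m * convolution s t m)
        ≈⟨ *-congˡ (qfact-*-convolution m) ⟩
      (X + pow q m * Y) * (qProduct X Y m * convolution s t 0)
        ≈⟨ solve 3 (λ z p c → z :* (p :* c) := (p :* z) :* c) refl _ _ _ ⟩
      qProduct X Y (suc m) * convolution s t 0 ∎

  module _ (qint-nonzero : ∀ k → ¬ qint (suc k) ≈ 0#) where

    qfact-nonzero : ∀ k → ¬ qfact k ≈ 0#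
    qfact-nonzero zero = 1≉0
    qfact-nonzero (suc k) = *-nonzero (qint-nonzero k) (qfact-nonzero k)

    qint-*-⁻¹qfact : ∀ k → qint (suc k) * qfact (suc k) ⁻¹ ≈ qfact k ⁻¹
    qint-*-⁻¹qfact k = begin
      qint (suc k) * (qint (suc k) * qfact k) ⁻¹
        ≈⟨ *-congˡ (⁻¹-distrib-* (qint-nonzero k) (qfact-nonzero k)) ⟩
      qint (suc k) * (qint (suc k) ⁻¹ * qfact k ⁻¹)
        ≈⟨ sym (*-assoc _ _ _) ⟩
      (qint (suc k) * qint (suc k) ⁻¹) * qfact k ⁻¹
        ≈⟨ trans (*-congʳ (⁻¹-inverse _ (qint-nonzero k))) (*-identityˡ _) ⟩
      qfact k ⁻¹ ∎

    binomial-2-suc : ∀ l → suc l C 2 ≡ l ℕ.+ l C 2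
    binomial-2-suc l = ≡.trans (≡.sym (nCk+nC[k+1]≡[n+1]C[k+1] l 1)) (≡.cong (ℕ._+ (l C 2)) (nC1≡n l))

    coeff-eOp-EOp : ∀ X Y p i →
      coeff (eOp X (EOp Y p)) i ≈ seriesCoeff (length p) (λ m → qfact m ⁻¹ * qProduct X Y m) (coeff p) i
    coeff-eOp-EOp X Y p i =
      trans (coeff-series-series e E p i) (seriesCoeff-cong (length p) {g = coeff p} closedForm (λ _ → refl) i)
      where
      e E : ℕ → Carrier
      e k = pow X k * qfact k ⁻¹
      E l = pow q (l C 2) * pow Y l * qfact l ⁻¹

      e-rec : ∀ k → qint (suc k) * e (suc k) ≈ X * e k
      e-rec k = begin
        qint (suc k) * ((X * pow X k) * qfact (suc k) ⁻¹)
          ≈⟨ solve 4 (λ a x p f → a :* ((x :* p) :* f) := x :* (p :* (a :* f))) refl _ _ _ _ ⟩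
        X * (pow X k * (qint (suc k) * qfact (suc k) ⁻¹))
          ≈⟨ *-congˡ (*-congˡ (qint-*-⁻¹qfact k)) ⟩
        X * e k ∎

      E-rec : ∀ l → qint (suc l) * E (suc l) ≈ (Y * pow q l) * E l
      E-rec l = begin
        qint (suc l) * ((pow q (suc l C 2) * (Y * pow Y l)) * qfact (suc l) ⁻¹)
          ≈⟨ *-congˡ (*-congʳ (*-congʳ (trans (reflexive (≡.cong (pow q) (binomial-2-suc l))) (pow-+ q l (l C 2))))) ⟩
        qint (suc l) * (((pow q l * pow q (l C 2)) * (Y * pow Y l)) * qfact (suc l) ⁻¹)
          ≈⟨ solve 6 (λ a u v y p f → a :* (((u :* v) :* (y :* p)) :* f) := (y :* u) :* ((v :* p) :* (a :* f)))
               refl (qint (suc l)) (pow q l) (pow q (l C 2)) Y (pow Y l) (qfact (suc l) ⁻¹) ⟩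
        (Y * pow q l) * (pow q (l C 2) * pow Y l * (qint (suc l) * qfact (suc l) ⁻¹))
          ≈⟨ *-congˡ (*-congˡ (qint-*-⁻¹qfact l)) ⟩
        (Y * pow q l) * E l ∎

      convolution₀≈1 : convolution e E 0 ≈ 1#
      convolution₀≈1 = trans (*-cong (trans (*-identityˡ _) 1⁻¹≈1) (trans (*-congʳ (*-identityˡ 1#)) (trans (*-identityˡ _) 1⁻¹≈1)))
                             (*-identityˡ 1#)

      closedForm : ∀ m → convolution e E m ≈ qfact m ⁻¹ * qProduct X Y m
      closedForm m = *-cancelˡ-⁻¹ (qfact-nonzero m)
        (trans (qfact-*-convolution e-rec E-rec m) (trans (*-congˡ convolution₀≈1) (*-identityʳ _)))

module Theorem {c ℓ} (F : Field c ℓ) (q : Field.Carrier F) where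
  open Field F
  open QCalculus F q
  open QCalculusProperties F q
  open FieldProperties F
  open import Relation.Binary.Reasoning.Setoid setoid
  open import Algebra.Properties.Ring ring using (-‿distribˡ-*; -‿distribʳ-*)
  open import Algebra.Properties.AbelianGroup +-abelianGroup using (⁻¹-∙-comm)
  open import Algebra.Properties.CommutativeSemigroup +-commutativeSemigroup using (interchange)
  open import Algebra.Solver.Ring.NaturalCoefficients.Default commutativeSemiring
    using (solve; _:+_; _:*_; _:=_; con)

  qpow-2-n≈q*qpow-1-n : ¬ q ≈ 0# → ∀ n′ → qpow (+ 2 ℤ.- + suc n′) ≈ q * qpow (+ 1 ℤ.- + suc n′)
  qpow-2-n≈q*qpow-1-n q≉0 zero = refl
  qpow-2-n≈q*qpow-1-n q≉0 (suc k) = sym (begin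
    q * (q ⁻¹ * pow (q ⁻¹) k)  ≈⟨ sym (*-assoc _ _ _) ⟩
    (q * q ⁻¹) * pow (q ⁻¹) k  ≈⟨ trans (*-congʳ (⁻¹-inverse q q≉0)) (*-identityˡ _) ⟩
    pow (q ⁻¹) k               ≈⟨ reflexive (pow-q⁻¹ k) ⟩
    qpow (+ 2 ℤ.- + suc (suc k)) ∎)
    where
    pow-q⁻¹ : ∀ k → pow (q ⁻¹) k ≡ qpow (+ 2 ℤ.- + suc (suc k))
    pow-q⁻¹ zero = ≡.refl
    pow-q⁻¹ (suc k) = ≡.refl

  module _ (q≉0 : ¬ q ≈ 0#) (qint-nonzero : ∀ k → ¬ qint (suc k) ≈ 0#) (a b : Carrier) (n′ : ℕ) where
    n : ℕ
    n = suc n′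

    c₁ c₂ X Y : Carrier
    c₁ = qpow (+ 1 ℤ.- + n)
    c₂ = qpow (+ 2 ℤ.- + n)
    X = (qint n * a + b) * c₁
    Y = - ((qint n′ * a + b) * c₂)

    rhsFactor : ℕ → Carrier
    rhsFactor m = (qint (suc m) - pow q n * qint m) * a + (1# - pow q (suc m)) * b

    X+qᵐY≈c₁*rhsFactor : ∀ m → X + pow q m * Y ≈ c₁ * rhsFactor m
    X+qᵐY≈c₁*rhsFactor m = begin
      X + pow q m * Y                          ≈⟨ +-congˡ (sym (-‿distribʳ-* _ _)) ⟩
      X + - (pow q m * (β * c₂))               ≈⟨ +-transpose-⁻ without-negation ⟩
      c₁ * (A * a + b) + - (c₁ * (B * a + C * b)) ≈⟨ sym expand ⟩
      c₁ * rhsFactor m ∎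
      where
      β A B C : Carrier
      β = qint n′ * a + b
      A = qint (suc m)
      B = pow q n * qint m
      C = pow q (suc m)

      -- [n] = 1 + q[n-1], and [n-1] + q^{n-1}[m] = [m] + qᵐ[n-1] since both are [n-1+m]
      without-negation : X + c₁ * (B * a + C * b) ≈ c₁ * (A * a + b) + pow q m * (β * c₂)
      without-negation = begin
        X + c₁ * (B * a + C * b)
          ≈⟨ solve 8 (λ Q N M c a b x y → (((con 1 :+ Q :* N) :* a :+ b) :* c) :+ c :* ((Q :* x) :* M :* a :+ (Q :* y) :* b)
                        := (c :* Q :* a) :* (N :+ x :* M) :+ (c :* (a :+ b) :+ c :* (Q :* y) :* b))
               refl q (qint n′) (qint m) c₁ a b (pow q n′) (pow q m) ⟩
        (c₁ * q * a) * (qint n′ + pow q n′ * qint m) + (c₁ * (a + b) + c₁ * (q * pow q m) * b)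
          ≈⟨ +-congʳ (*-congˡ (qint-+-comm n′ m)) ⟩
        (c₁ * q * a) * (qint m + pow q m * qint n′) + (c₁ * (a + b) + c₁ * (q * pow q m) * b)
          ≈⟨ solve 8 (λ Q N M c a b x y → (c :* Q :* a) :* (M :+ y :* N) :+ (c :* (a :+ b) :+ c :* (Q :* y) :* b)
                        := c :* ((con 1 :+ Q :* M) :* a :+ b) :+ y :* ((N :* a :+ b) :* (Q :* c)))
               refl q (qint n′) (qint m) c₁ a b (pow q n′) (pow q m) ⟩
        c₁ * (A * a + b) + pow q m * (β * (q * c₁))
          ≈⟨ +-congˡ (*-congˡ (*-congˡ (sym (qpow-2-n≈q*qpow-1-n q≉0 n′)))) ⟩
        c₁ * (A * a + b) + pow q m * (β * c₂) ∎

      expand : c₁ * rhsFactor m ≈ c₁ * (A * a + b) + - (c₁ * (B * a + C * b))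
      expand = begin
        c₁ * ((A + - B) * a + (1# + - C) * b)
          ≈⟨ *-congˡ (+-cong (trans (distribʳ _ _ _) (+-congˡ (sym (-‿distribˡ-* _ _))))
                             (trans (distribʳ _ _ _) (+-cong (*-identityˡ _) (sym (-‿distribˡ-* _ _))))) ⟩
        c₁ * ((A * a + - (B * a)) + (b + - (C * b)))
          ≈⟨ *-congˡ (trans (interchange _ _ _ _) (+-congˡ (⁻¹-∙-comm _ _))) ⟩
        c₁ * ((A * a + b) + - (B * a + C * b))
          ≈⟨ distribˡ _ _ _ ⟩
        c₁ * (A * a + b) + c₁ * - (B * a + C * b)
          ≈⟨ +-congˡ (sym (-‿distribʳ-* _ _)) ⟩
        c₁ * (A * a + b) + - (c₁ * (B * a + C * b)) ∎

    qProduct≈c₁ᵐ*prodCoef : ∀ m → qProduct X Y m ≈ pow c₁ m * prodCoef a b n m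
    qProduct≈c₁ᵐ*prodCoef zero = sym (*-identityˡ _)
    qProduct≈c₁ᵐ*prodCoef (suc m) = begin
      qProduct X Y m * (X + pow q m * Y)
        ≈⟨ *-cong (qProduct≈c₁ᵐ*prodCoef m) (X+qᵐY≈c₁*rhsFactor m) ⟩
      (pow c₁ m * prodCoef a b n m) * (c₁ * rhsFactor m)
        ≈⟨ solve 4 (λ x y z w → (x :* y) :* (z :* w) := (z :* x) :* (y :* w)) refl _ _ _ _ ⟩
      pow c₁ (suc m) * prodCoef a b n (suc m) ∎

    coeff-Q≈coeff-RHS : ∀ p i → coeff (Q a b n p) i ≈ coeff (RHS a b n p) i
    coeff-Q≈coeff-RHS p i = begin
      coeff (Q a b n p) i
        ≈⟨ coeff-scaleD c₁ (eOp X (EOp Y p)) i ⟩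
      c₁ * (qint (suc i) * coeff (eOp X (EOp Y p)) (suc i))
        ≈⟨ *-congˡ (*-congˡ (coeff-eOp-EOp qint-nonzero X Y p (suc i))) ⟩
      c₁ * (qint (suc i) * seriesCoeff (length p) (λ m → qfact m ⁻¹ * qProduct X Y m) (coeff p) (suc i))
        ≈⟨ *-congˡ (*-congˡ (seriesCoeff-cong (length p) {g = coeff p} coefficients≈ (λ _ → refl) (suc i))) ⟩
      c₁ * (qint (suc i) * seriesCoeff (length p) (λ m → ρ m * pow c₁ m) (coeff p) (suc i))
        ≈⟨ sym (coeff-∑-iter-scaleD c₁ ρ p i) ⟩
      coeff (RHS a b n p) i ∎
      where
      ρ : ℕ → Carrier
      ρ m = prodCoef a b n m * qfact m ⁻¹

      coefficients≈ : ∀ m → qfact m ⁻¹ * qProduct X Y m ≈ ρ m * pow c₁ m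
      coefficients≈ m = trans (*-congˡ (qProduct≈c₁ᵐ*prodCoef m))
        (solve 3 (λ f c p → f :* (c :* p) := (p :* f) :* c) refl _ _ _)

mainTheorem7 : ∀ {c ℓ} (F : Field c ℓ) (q : Field.Carrier F) →
    ¬ (Field._≈_ F q (Field.0# F)) →
    (∀ k → ¬ (Field._≈_ F (QCalculus.qint F q (suc k)) (Field.0# F))) →
    (a b : Field.Carrier F) (n : ℕ) → n ≥ 1 →
    (p : QCalculus.Poly F q) (i : ℕ) →
    Field._≈_ F (QCalculus.coeff F q (QCalculus.Q F q a b n p) i)
                (QCalculus.coeff F q (QCalculus.RHS F q a b n p) i)
mainTheorem7 F q q≉0 qint-nonzero a b (suc n′) _ = Theorem.coeff-Q≈coeff-RHS F q q≉0 qint-nonzero a b n′
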